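{- Let $k\ge 1$ and let $G$ be a graph with minimum degree at least $k$, with $n$ vertices and $m$ edges. Then $$\gamma_{\times k,t}^{r}(G)\ge \frac{3n}{2}-\frac{m}{k}.$$
   Context: All graphs are finite and simple; $N(x)$ denotes the open neighborhood of $x$. For an integer $k\ge 1$, a set $S\subseteq V(G)$ is a $k$-tuple total dominating set of $G$ if $|N(x)\cap S|\ge k$ for every $x\in V(G)$. It is a $k$-tuple total restrained dominating set (kTRDS) if moreover every vertex $x\in V(G)\setminus S$ is adjacent to at least $k$ vertices of $V(G)\setminus S$. For a graph with minimum degree at least $k$, $\gamma_{\times k,t}^{r}(G)$ denotes the minimum cardinality of a kTRDS of $G$. -}

module Defs where

open import Data.Nat using (ℕ; _≤_; _<ᵇ_)
open import Data.Bool using (Bool; true; false; _∧_; not)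
open import Data.Fin using (Fin; toℕ)
open import Data.Fin.Subset using (Subset; _∈_; _∉_; ∣_∣)
open import Data.Vec using (tabulate; countᵇ; lookup; sum)
open import Relation.Binary.PropositionalEquality using (_≡_)

record Graph (n : ℕ) : Set where
  field
    adj         : Fin n → Fin n → Bool
    symmetric   : ∀ x y → adj x y ≡ adj y x
    irreflexive : ∀ x → adj x x ≡ false
open Graph public

countV : {n : ℕ} → (Fin n → Bool) → ℕ
countV {n} p = countᵇ p (tabulate {n = n} (λ y → y))

degree : {n : ℕ} → Graph n → Fin n → ℕ
degree G x = countV (adj G x)

MinDegreeAtLeast : {n : ℕ} → Graph n → ℕ → Set
MinDegreeAtLeast G k = ∀ x → k ≤ degree G x

inS : {n : ℕ} → Subset n → Fin n → Bool
inS S y = lookup S y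

nbrsIn : {n : ℕ} → Graph n → Subset n → Fin n → ℕ
nbrsIn G S x = countV (λ y → adj G x y ∧ inS S y)

nbrsOut : {n : ℕ} → Graph n → Subset n → Fin n → ℕ
nbrsOut G S x = countV (λ y → adj G x y ∧ not (inS S y))

edgeCount : {n : ℕ} → Graph n → ℕ
edgeCount {n} G =
  sum (tabulate {n = n} (λ x → countV (λ y → (toℕ x <ᵇ toℕ y) ∧ adj G x y)))

IsKTRDS : {n : ℕ} → Graph n → ℕ → Subset n → Set
IsKTRDS {n} G k S =
  (∀ (x : Fin n) → k ≤ nbrsIn G S x) ×
  (∀ (x : Fin n) → x ∉ S → k ≤ nbrsOut G S x)
  where open import Data.Product using (_×_)

-- S is a kTRDS of minimum cardinality, i.e. ∣ S ∣ = γ^r_{×k,t}(G)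
IsMinKTRDS : {n : ℕ} → Graph n → ℕ → Subset n → Set
IsMinKTRDS {n} G k S =
  IsKTRDS G k S × (∀ (T : Subset n) → IsKTRDS G k T → ∣ S ∣ ≤ ∣ T ∣)
  where open import Data.Product using (_×_)

-- Write I x = |N(x) ∩ S| and O x = |N(x) ∖ S|. Double counting the edges between S
-- and its complement gives Σ_{x ∈ S} O x = Σ_{x ∉ S} I x, hence
-- 2m = Σ_x deg x = Σ_x I x + Σ_{x ∉ S} deg x. Every vertex has I x ≥ k, and every
-- x ∉ S also has deg x = I x + O x ≥ 2k, so summing 3k ≤ 2k[x ∈ S] + I x + [x ∉ S] deg x
-- over all vertices gives 3kn ≤ 2k|S| + 2m.
module Submission where

open import Data.Bool using (Bool; true; false; _∧_; not)
open import Data.Empty using (⊥-elim)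
open import Data.Fin using (Fin; toℕ; zero; suc)
open import Data.Fin.Properties using (toℕ-injective)
open import Data.Fin.Subset using (Subset; _∉_; ∣_∣)
open import Data.Nat using (ℕ; zero; suc; _+_; _*_; _≤_; _<ᵇ_; z≤n)
open import Data.Nat.Properties
open import Data.Product using (_,_)
open import Data.Vec using ([]; _∷_; tabulate; countᵇ; lookup)
import Data.Vec as Vec
open import Data.Vec.Properties using ([]=⇒lookup)
open import Relation.Binary.PropositionalEquality
  using (_≡_; refl; sym; trans; cong; cong₂; module ≡-Reasoning)
open import Relation.Nullary.Reflects using (ofʸ; ofⁿ)
open import Algebra.Properties.Semiring.Sum +-*-semiring
  using (sum; sum-syntax; ∑-distrib-+; ∑-comm; *-distribˡ-sum; sum-cong-≗)

open import Defs

⟦_⟧ : Bool → ℕ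
⟦ true ⟧  = 1
⟦ false ⟧ = 0

⟦⟧*⟦∧⟧-comm : ∀ p a q → ⟦ p ⟧ * ⟦ a ∧ q ⟧ ≡ ⟦ q ⟧ * ⟦ a ∧ p ⟧
⟦⟧*⟦∧⟧-comm p true  q = *-comm ⟦ p ⟧ ⟦ q ⟧
⟦⟧*⟦∧⟧-comm p false q = trans (*-zeroʳ ⟦ p ⟧) (sym (*-zeroʳ ⟦ q ⟧))

⟦⟧-split : ∀ a b → ⟦ a ⟧ ≡ ⟦ a ∧ b ⟧ + ⟦ a ∧ not b ⟧
⟦⟧-split true  true  = refl
⟦⟧-split true  false = refl
⟦⟧-split false b     = refl

sum-mono-≤ : ∀ {n} {f g : Fin n → ℕ} → (∀ i → f i ≤ g i) → sum f ≤ sum g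
sum-mono-≤ {zero}  f≤g = z≤n
sum-mono-≤ {suc n} f≤g = +-mono-≤ (f≤g zero) (sum-mono-≤ (λ i → f≤g (suc i)))

sum-const : ∀ n c → ∑[ i < n ] c ≡ n * c
sum-const zero    c = refl
sum-const (suc n) c = cong (c +_) (sum-const n c)

sum-split : ∀ {n} (b : Fin n → Bool) (f : Fin n → ℕ) →
  sum f ≡ ∑[ i < n ] (⟦ b i ⟧ * f i) + ∑[ i < n ] (⟦ not (b i) ⟧ * f i)
sum-split b f = trans (sum-cong-≗ split)
  (∑-distrib-+ (λ i → ⟦ b i ⟧ * f i) (λ i → ⟦ not (b i) ⟧ * f i))
  where
  split : ∀ i → f i ≡ ⟦ b i ⟧ * f i + ⟦ not (b i) ⟧ * f i
  split i with b i
  ... | true  = sym (trans (+-identityʳ (1 * f i)) (*-identityˡ (f i)))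
  ... | false = sym (*-identityˡ (f i))

Vec-sum-tabulate : ∀ {n} (f : Fin n → ℕ) → Vec.sum (tabulate f) ≡ sum f
Vec-sum-tabulate {zero}  f = refl
Vec-sum-tabulate {suc n} f = cong (f zero +_) (Vec-sum-tabulate (λ i → f (suc i)))

countᵇ-tabulate : ∀ {n} {A : Set} (p : A → Bool) (f : Fin n → A) →
  countᵇ p (tabulate f) ≡ ∑[ i < n ] ⟦ p (f i) ⟧
countᵇ-tabulate {zero}  p f = refl
countᵇ-tabulate {suc n} p f with p (f zero)
... | true  = cong suc (countᵇ-tabulate p (λ i → f (suc i)))
... | false = countᵇ-tabulate p (λ i → f (suc i))

countV≡sum : ∀ {n} (p : Fin n → Bool) → countV p ≡ ∑[ i < n ] ⟦ p i ⟧
countV≡sum p = countᵇ-tabulate p (λ i → i)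

∣∣≡sum : ∀ {n} (S : Subset n) → ∣ S ∣ ≡ ∑[ i < n ] ⟦ lookup S i ⟧
∣∣≡sum []          = refl
∣∣≡sum (true ∷ S)  = cong suc (∣∣≡sum S)
∣∣≡sum (false ∷ S) = ∣∣≡sum S

countV-split : ∀ {n} (p q : Fin n → Bool) →
  countV p ≡ countV (λ i → p i ∧ q i) + countV (λ i → p i ∧ not (q i))
countV-split p q = begin
  countV p
    ≡⟨ countV≡sum p ⟩
  sum (λ i → ⟦ p i ⟧)
    ≡⟨ sum-cong-≗ (λ i → ⟦⟧-split (p i) (q i)) ⟩
  sum (λ i → ⟦ p i ∧ q i ⟧ + ⟦ p i ∧ not (q i) ⟧)
    ≡⟨ ∑-distrib-+ (λ i → ⟦ p i ∧ q i ⟧) (λ i → ⟦ p i ∧ not (q i) ⟧) ⟩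
  sum (λ i → ⟦ p i ∧ q i ⟧) + sum (λ i → ⟦ p i ∧ not (q i) ⟧)
    ≡⟨ sym (cong₂ _+_ (countV≡sum (λ i → p i ∧ q i)) (countV≡sum (λ i → p i ∧ not (q i)))) ⟩
  countV (λ i → p i ∧ q i) + countV (λ i → p i ∧ not (q i)) ∎
  where open ≡-Reasoning

module _ {n : ℕ} (G : Graph n) where

  degree≡nbrsIn+nbrsOut : ∀ S x → degree G x ≡ nbrsIn G S x + nbrsOut G S x
  degree≡nbrsIn+nbrsOut S x = countV-split (adj G x) (inS S)

  ⟦adj⟧-loop : ∀ {x y} → x ≡ y → ⟦ adj G x y ⟧ ≡ 0
  ⟦adj⟧-loop {x} refl = cong ⟦_⟧ (irreflexive G x)

  ⟦adj⟧-orient : ∀ x y →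
    ⟦ adj G x y ⟧ ≡ ⟦ (toℕ x <ᵇ toℕ y) ∧ adj G x y ⟧ + ⟦ (toℕ y <ᵇ toℕ x) ∧ adj G y x ⟧
  ⟦adj⟧-orient x y
    with toℕ x <ᵇ toℕ y | <ᵇ-reflects-< (toℕ x) (toℕ y)
       | toℕ y <ᵇ toℕ x | <ᵇ-reflects-< (toℕ y) (toℕ x)
  ... | true  | ofʸ x<y | true  | ofʸ y<x = ⊥-elim (<-asym x<y y<x)
  ... | true  | _       | false | _       = sym (+-identityʳ ⟦ adj G x y ⟧)
  ... | false | _       | true  | _       = cong ⟦_⟧ (symmetric G x y)
  ... | false | ofⁿ x≮y | false | ofⁿ y≮x =
    ⟦adj⟧-loop (toℕ-injective (≤-antisym (≮⇒≥ y≮x) (≮⇒≥ x≮y)))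

  edgeCount≡sum : edgeCount G ≡ ∑[ x < n ] ∑[ y < n ] ⟦ (toℕ x <ᵇ toℕ y) ∧ adj G x y ⟧
  edgeCount≡sum = trans (Vec-sum-tabulate (λ x → countV (λ y → (toℕ x <ᵇ toℕ y) ∧ adj G x y)))
    (sum-cong-≗ (λ x → countV≡sum (λ y → (toℕ x <ᵇ toℕ y) ∧ adj G x y)))

  sum-degree : ∑[ x < n ] degree G x ≡ 2 * edgeCount G
  sum-degree = begin
    ∑[ x < n ] degree G x
      ≡⟨ sum-cong-≗ (λ x → countV≡sum (adj G x)) ⟩
    ∑[ x < n ] ∑[ y < n ] ⟦ adj G x y ⟧
      ≡⟨ sum-cong-≗ (λ x → trans (sum-cong-≗ (⟦adj⟧-orient x)) (∑-distrib-+ (e x) (λ y → e y x))) ⟩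
    ∑[ x < n ] (∑[ y < n ] e x y + ∑[ y < n ] e y x)
      ≡⟨ ∑-distrib-+ (λ x → ∑[ y < n ] e x y) (λ x → ∑[ y < n ] e y x) ⟩
    E + ∑[ x < n ] ∑[ y < n ] e y x
      ≡⟨ cong (E +_) (∑-comm (λ x y → e y x)) ⟩
    E + E
      ≡⟨ cong (λ m → m + m) (sym edgeCount≡sum) ⟩
    edgeCount G + edgeCount G
      ≡⟨ cong (edgeCount G +_) (sym (+-identityʳ (edgeCount G))) ⟩
    2 * edgeCount G ∎
    where
    open ≡-Reasoning
    e : Fin n → Fin n → ℕ
    e x y = ⟦ (toℕ x <ᵇ toℕ y) ∧ adj G x y ⟧
    E : ℕ
    E = ∑[ x < n ] ∑[ y < n ] e x y

  edgesBetween : (Fin n → Bool) → (Fin n → Bool) → ℕ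
  edgesBetween P Q = ∑[ x < n ] (⟦ P x ⟧ * countV (λ y → adj G x y ∧ Q y))

  edgesBetween-comm : ∀ P Q → edgesBetween P Q ≡ edgesBetween Q P
  edgesBetween-comm P Q = begin
    edgesBetween P Q                              ≡⟨ expand P Q ⟩
    ∑[ x < n ] ∑[ y < n ] term P Q x y            ≡⟨ ∑-comm (term P Q) ⟩
    ∑[ y < n ] ∑[ x < n ] term P Q x y            ≡⟨ sum-cong-≗ (λ y → sum-cong-≗ (λ x → term-comm x y)) ⟩
    ∑[ y < n ] ∑[ x < n ] term Q P y x            ≡⟨ sym (expand Q P) ⟩
    edgesBetween Q P                              ∎
    where
    open ≡-Reasoning
    term : (Fin n → Bool) → (Fin n → Bool) → Fin n → Fin n → ℕ
    term P Q x y = ⟦ P x ⟧ * ⟦ adj G x y ∧ Q y ⟧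

    expand : ∀ P Q → edgesBetween P Q ≡ ∑[ x < n ] ∑[ y < n ] term P Q x y
    expand P Q = sum-cong-≗ λ x →
      trans (cong (⟦ P x ⟧ *_) (countV≡sum (λ y → adj G x y ∧ Q y)))
            (*-distribˡ-sum ⟦ P x ⟧ (λ y → ⟦ adj G x y ∧ Q y ⟧))

    term-comm : ∀ x y → term P Q x y ≡ term Q P y x
    term-comm x y = trans (⟦⟧*⟦∧⟧-comm (P x) (adj G x y) (Q y))
      (cong (λ a → ⟦ Q y ⟧ * ⟦ a ∧ P x ⟧) (symmetric G x y))

  twice-edgeCount : ∀ S → 2 * edgeCount G ≡
    ∑[ x < n ] (nbrsIn G S x + ⟦ not (inS S x) ⟧ * degree G x)
  twice-edgeCount S = begin
    2 * edgeCount G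
      ≡⟨ sym sum-degree ⟩
    ∑[ x < n ] degree G x
      ≡⟨ sum-cong-≗ (degree≡nbrsIn+nbrsOut S) ⟩
    ∑[ x < n ] (I x + O x)
      ≡⟨ ∑-distrib-+ I O ⟩
    sum I + sum O
      ≡⟨ cong (sum I +_) (sum-split s O) ⟩
    sum I + (edgesBetween s s̄ + ∑[ x < n ] (⟦ s̄ x ⟧ * O x))
      ≡⟨ cong (λ c → sum I + (c + ∑[ x < n ] (⟦ s̄ x ⟧ * O x))) (edgesBetween-comm s s̄) ⟩
    sum I + (∑[ x < n ] (⟦ s̄ x ⟧ * I x) + ∑[ x < n ] (⟦ s̄ x ⟧ * O x))
      ≡⟨ cong (sum I +_) (sym (∑-distrib-+ (λ x → ⟦ s̄ x ⟧ * I x) (λ x → ⟦ s̄ x ⟧ * O x))) ⟩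
    sum I + ∑[ x < n ] (⟦ s̄ x ⟧ * I x + ⟦ s̄ x ⟧ * O x)
      ≡⟨ cong (sum I +_) (sum-cong-≗ λ x →
           trans (sym (*-distribˡ-+ ⟦ s̄ x ⟧ (I x) (O x)))
                 (cong (⟦ s̄ x ⟧ *_) (sym (degree≡nbrsIn+nbrsOut S x)))) ⟩
    sum I + ∑[ x < n ] (⟦ s̄ x ⟧ * degree G x)
      ≡⟨ sym (∑-distrib-+ I (λ x → ⟦ s̄ x ⟧ * degree G x)) ⟩
    ∑[ x < n ] (I x + ⟦ s̄ x ⟧ * degree G x) ∎
    where
    open ≡-Reasoning
    s s̄ : Fin n → Bool
    s x = inS S x
    s̄ x = not (inS S x)
    I O : Fin n → ℕ
    I = nbrsIn G S
    O = nbrsOut G S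

  kTRDS-local-bound : ∀ {k S} → IsKTRDS G k S → ∀ x →
    3 * k ≤ 2 * k * ⟦ inS S x ⟧ + (nbrsIn G S x + ⟦ not (inS S x) ⟧ * degree G x)
  kTRDS-local-bound {k} {S} (inDom , outDom) x with inS S x in x∈?S
  ... | true  = begin
    3 * k                          ≡⟨ +-comm k (2 * k) ⟩
    2 * k + k                      ≤⟨ +-mono-≤ (≤-reflexive (sym (*-identityʳ (2 * k))))
                                               (m≤n⇒m≤n+o 0 (inDom x)) ⟩
    2 * k * 1 + (nbrsIn G S x + 0) ∎
    where open ≤-Reasoning
  ... | false = begin
    3 * k                          ≤⟨ +-mono-≤ (inDom x)
                                         (+-mono-≤ (inDom x) (+-mono-≤ (outDom x x∉S) z≤n)) ⟩
    I + (I + (O + 0))              ≡⟨ cong (I +_) (sym (+-assoc I O 0)) ⟩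
    I + (I + O + 0)                ≡⟨ cong₂ _+_ (sym (*-zeroʳ (2 * k)))
                                                (cong (λ d → I + (d + 0)) (sym (degree≡nbrsIn+nbrsOut S x))) ⟩
    2 * k * 0 + (I + 1 * degree G x) ∎
    where
    open ≤-Reasoning
    I O : ℕ
    I = nbrsIn G S x
    O = nbrsOut G S x
    x∉S : x ∉ S
    x∉S x∈S with () ← trans (sym ([]=⇒lookup x∈S)) x∈?S

theorem3p3 : (k n : ℕ) → 1 ≤ k → (G : Graph n) → MinDegreeAtLeast G k →
    (S : Subset n) → IsMinKTRDS G k S →
    3 * k * n ≤ 2 * k * ∣ S ∣ + 2 * edgeCount G
theorem3p3 k n _ G _ S (S-kTRDS , _) = begin
  3 * k * n
    ≡⟨ trans (*-comm (3 * k) n) (sym (sum-const n (3 * k))) ⟩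
  ∑[ x < n ] (3 * k)
    ≤⟨ sum-mono-≤ (kTRDS-local-bound G S-kTRDS) ⟩
  ∑[ x < n ] (2 * k * ⟦ inS S x ⟧ + rest x)
    ≡⟨ ∑-distrib-+ (λ x → 2 * k * ⟦ inS S x ⟧) rest ⟩
  ∑[ x < n ] (2 * k * ⟦ inS S x ⟧) + sum rest
    ≡⟨ cong₂ _+_ (sym (*-distribˡ-sum (2 * k) (λ x → ⟦ inS S x ⟧))) (sym (twice-edgeCount G S)) ⟩
  2 * k * ∑[ x < n ] ⟦ inS S x ⟧ + 2 * edgeCount G
    ≡⟨ cong (λ c → 2 * k * c + 2 * edgeCount G) (sym (∣∣≡sum S)) ⟩
  2 * k * ∣ S ∣ + 2 * edgeCount G ∎
  where
  open ≤-Reasoning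
  rest : Fin n → ℕ
  rest x = nbrsIn G S x + ⟦ not (inS S x) ⟧ * degree G x
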